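{- Every function $f$ in the support of $\mathcal D_{\mathrm{yes}}$ is monotone.
   Context: $n$ is divisible by $4$, $\|x\|_1$ is Hamming weight, $L:=(4/3)^n$ and $M:=4^n$. Terms $T_i:[n]\to[n]$ ($i\in[L]$) are identified with $T_i(x)=\bigwedge_{k\in[n]}x_{T_i(k)}$; clauses $C_{i,j}:[n]\to[n]$ ($i\in[L],j\in[M]$) are identified with $C_{i,j}(x)=\bigvee_{k\in[n]}x_{C_{i,j}(k)}$. The multiplexer $\Gamma=\Gamma_{T,C}:\{0,1\}^n\to([L]\times[M])\cup\{0^*,1^*\}$: $\Gamma(x)=0^*$ if no term is satisfied; $\Gamma(x)=1^*$ if at least two terms are satisfied; otherwise let $i'$ be the unique satisfied term: $\Gamma(x)=1^*$ if $C_{i',j}(x)=1$ for all $j\in[M]$, $\Gamma(x)=0^*$ if $C_{i',j}(x)=0$ for at least two $j$, and $\Gamma(x)=(i',j')$ if $j'$ is the unique $j$ with $C_{i',j}(x)=0$. A draw $f\sim\mathcal D_{\mathrm{yes}}$: all $T_i(k)$ and $C_{i,j}(k)$ independent uniform in $[n]$; independently each $h_{i,j}$ is, with probability $2/3$, a dictator $x\mapsto x_k$ with $k$ uniform in $[n]$, and with probability $1/3$ the constant-$0$ function; $f(x)=1$ if $\|x\|_1>3n/4+1$, $f(x)=0$ if $\|x\|_1<3n/4$, and for $\|x\|_1\in\{3n/4,3n/4+1\}$: $f(x)=0$ if $\Gamma(x)=0^*$, $1$ if $\Gamma(x)=1^*$, and $h_{\Gamma(x)}(x)$ otherwise. Monotone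 means $x\preceq y$ coordinatewise implies $f(x)\le f(y)$. -}

module Defs where

open import Data.Nat using (ℕ; _+_; _*_; _^_; _<ᵇ_)
open import Data.Nat.DivMod using (_/_)
open import Data.Nat.Properties using (m^n≢0)
open import Data.Bool.ListAction using (and; or)
import Data.Bool
open import Data.Bool using (Bool; true; false; not; if_then_else_)
open import Data.Fin using (Fin)
open import Data.List using (List; []; _∷_; map; filterᵇ; length; allFin)

Cube : ℕ → Set
Cube n = Fin n → Bool

weight : ∀ {n} → Cube n → ℕ
weight {n} x = length (filterᵇ x (allFin n))

-- L := (4/3)^n, read as ⌊4^n / 3^n⌋ (so [L] is a finite index set); M := 4^n.
Lsize : ℕ → ℕ
Lsize n = _/_ (4 ^ n) (3 ^ n) {{m^n≢0 3 n}}

Msize : ℕ → ℕ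
Msize n = 4 ^ n

evalTerm : ∀ {n} → (Fin n → Fin n) → Cube n → Bool
evalTerm {n} t x = and (map (λ k → x (t k)) (allFin n))

evalClause : ∀ {n} → (Fin n → Fin n) → Cube n → Bool
evalClause {n} c x = or (map (λ k → x (c k)) (allFin n))

data MuxOut (l m : ℕ) : Set where
  zero* : MuxOut l m
  one*  : MuxOut l m
  idx   : Fin l → Fin m → MuxOut l m

Terms : ℕ → Set
Terms n = Fin (Lsize n) → Fin n → Fin n

Clauses : ℕ → Set
Clauses n = Fin (Lsize n) → Fin (Msize n) → Fin n → Fin n

Γ : ∀ {n} → Terms n → Clauses n → Cube n → MuxOut (Lsize n) (Msize n)
Γ {n} T C x with filterᵇ (λ i → evalTerm (T i) x) (allFin (Lsize n))
... | [] = zero*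
... | i ∷ [] with filterᵇ (λ j → not (evalClause (C i j) x)) (allFin (Msize n))
...   | [] = one*
...   | j ∷ [] = idx i j
...   | _ ∷ _ ∷ _ = zero*
Γ {n} T C x | _ ∷ _ ∷ _ = one*

-- The support of each h_{i,j}: a dictator x ↦ x_k, or the constant-0 function.
data HFun (n : ℕ) : Set where
  dictator : Fin n → HFun n
  const0   : HFun n

evalH : ∀ {n} → HFun n → Cube n → Bool
evalH (dictator k) x = x k
evalH const0       x = false

Hs : ℕ → Set
Hs n = Fin (Lsize n) → Fin (Msize n) → HFun n

-- The function f determined by (T, C, h); 3n/4 is exact since 4 ∣ n.
fYes : ∀ {n} → Terms n → Clauses n → Hs n → Cube n → Bool
fYes {n} T C h x =
  if (3 * n / 4 + 1) <ᵇ weight x then true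
  else if weight x <ᵇ (3 * n / 4) then false
  else mux (Γ T C x)
  where
  mux : MuxOut (Lsize n) (Msize n) → Bool
  mux zero*     = false
  mux one*      = true
  mux (idx i j) = evalH (h i j) x

_⪯_ : ∀ {n} → Cube n → Cube n → Set
_⪯_ {n} x y = (k : Fin n) → Data.Bool._≤_ (x k) (y k)

Monotone : ∀ {n} → (Cube n → Bool) → Set
Monotone {n} f = (x y : Cube n) → x ⪯ y → Data.Bool._≤_ (f x) (f y)

-- Along x ⪯ y every term satisfied at x is satisfied at y and every clause falsified at y
-- is falsified at x. So the set of satisfied terms can only grow and, once the active term
-- is fixed, the set of falsified clauses can only shrink; Γ reads these sets through the
-- order 0* < (i, j) < 1*, and the dictators and the constant 0 are monotone. The weight
-- thresholds only help, since the weight is monotone.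
module Submission where

open import Defs
open import Data.Nat using (ℕ; _<ᵇ_; _*_; _+_; _/_)
import Data.Nat as ℕ
import Data.Nat.Properties as ℕ
open import Data.Nat.Divisibility using (_∣_)
open import Data.Bool using (Bool; true; false; not; _∧_; _∨_; T; if_then_else_; _≤_; b≤b; f≤t)
open import Data.Bool.Properties using (≤-minimum; ≤-maximum)
open import Data.Bool.ListAction using (and; or)
open import Data.Empty using (⊥-elim)
open import Data.Fin using (Fin)
open import Data.List using (List; []; _∷_; map; filterᵇ; allFin)
open import Data.List.Relation.Binary.Sublist.Propositional using (_⊆_; []; _∷_; _∷ʳ_; ⊆-reflexive)
open import Data.List.Relation.Binary.Sublist.Propositional.Properties using (filter⁺; length-mono-≤)
open import Relation.Binary.PropositionalEquality using (_≡_; refl; sym; subst₂)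
open import Relation.Nullary.Decidable using (T?)
open import Function using (_∘_)

∧-mono-≤ : ∀ {a b c d} → a ≤ b → c ≤ d → a ∧ c ≤ b ∧ d
∧-mono-≤ {false} _   _   = ≤-minimum _
∧-mono-≤ {true}  b≤b c≤d = c≤d

∨-mono-≤ : ∀ {a b c d} → a ≤ b → c ≤ d → a ∨ c ≤ b ∨ d
∨-mono-≤ {false} {false} _ c≤d = c≤d
∨-mono-≤ {false} {true}  _ _   = ≤-maximum _
∨-mono-≤ {true}  b≤b     _     = b≤b

not-antimono-≤ : ∀ {a b} → a ≤ b → not b ≤ not a
not-antimono-≤ {false} {false} _ = b≤b
not-antimono-≤ {false} {true}  _ = f≤t
not-antimono-≤ {true}  b≤b       = b≤b

T-mono-≤ : ∀ {a b} → a ≤ b → T a → T b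
T-mono-≤ b≤b Ta = Ta

T⇒T-≤ : ∀ {a b} → (T a → T b) → a ≤ b
T⇒T-≤ {false}        _     = ≤-minimum _
T⇒T-≤ {true} {true}  _     = b≤b
T⇒T-≤ {true} {false} Ta⇒Tb = ⊥-elim (Ta⇒Tb _)

module _ {A : Set} {f g : A → Bool} (f≤g : ∀ a → f a ≤ g a) where

  and-map-mono-≤ : ∀ xs → and (map f xs) ≤ and (map g xs)
  and-map-mono-≤ []       = b≤b
  and-map-mono-≤ (a ∷ xs) = ∧-mono-≤ (f≤g a) (and-map-mono-≤ xs)

  or-map-mono-≤ : ∀ xs → or (map f xs) ≤ or (map g xs)
  or-map-mono-≤ []       = b≤b
  or-map-mono-≤ (a ∷ xs) = ∨-mono-≤ (f≤g a) (or-map-mono-≤ xs)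

  filterᵇ-mono-⊆ : ∀ xs → filterᵇ f xs ⊆ filterᵇ g xs
  filterᵇ-mono-⊆ xs = filter⁺ (T? ∘ f) (T? ∘ g) (λ { refl → T-mono-≤ (f≤g _) }) (⊆-reflexive {x = xs} refl)

module _ {u v : ℕ} (u≤v : u ℕ.≤ v) where

  <ᵇ-monoʳ-≤ : ∀ k → (k <ᵇ u) ≤ (k <ᵇ v)
  <ᵇ-monoʳ-≤ k = T⇒T-≤ (λ k<u → ℕ.<⇒<ᵇ (ℕ.<-≤-trans (ℕ.<ᵇ⇒< k u k<u) u≤v))

  <ᵇ-antimonoˡ-≤ : ∀ k → (v <ᵇ k) ≤ (u <ᵇ k)
  <ᵇ-antimonoˡ-≤ k = T⇒T-≤ (λ v<k → ℕ.<⇒<ᵇ (ℕ.≤-<-trans u≤v (ℕ.<ᵇ⇒< v k v<k)))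

cascade : Bool → Bool → Bool → Bool
cascade up down b = if up then true else if down then false else b

cascade-mono : ∀ {up up′ down down′ b b′} → up ≤ up′ → down′ ≤ down → b ≤ b′ →
               cascade up down b ≤ cascade up′ down′ b′
cascade-mono {true}                  b≤b _   _    = b≤b
cascade-mono {false} {true}          _   _   _    = ≤-maximum _
cascade-mono {false} {false} {true}  _   _   _    = ≤-minimum _
cascade-mono {false} {false} {false} _   b≤b b≤b′ = b≤b′

threshold : ℕ → ℕ → ℕ → Bool → Bool
threshold hi lo w = cascade (hi <ᵇ w) (w <ᵇ lo)

threshold-mono : ∀ hi lo {w w′ b b′} → w ℕ.≤ w′ → b ≤ b′ → threshold hi lo w b ≤ threshold hi lo w′ b′
threshold-mono hi lo w≤w′ = cascade-mono (<ᵇ-monoʳ-≤ w≤w′ hi) (<ᵇ-antimonoˡ-≤ w≤w′ lo)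

module _ {n : ℕ} {x y : Cube n} (x⪯y : x ⪯ y) where

  weight-mono-≤ : weight x ℕ.≤ weight y
  weight-mono-≤ = length-mono-≤ (filterᵇ-mono-⊆ x⪯y (allFin n))

  evalTerm-mono-≤ : ∀ t → evalTerm t x ≤ evalTerm t y
  evalTerm-mono-≤ t = and-map-mono-≤ (x⪯y ∘ t) (allFin n)

  evalClause-mono-≤ : ∀ c → evalClause c x ≤ evalClause c y
  evalClause-mono-≤ c = or-map-mono-≤ (x⪯y ∘ c) (allFin n)

  evalH-mono-≤ : ∀ g → evalH g x ≤ evalH g y
  evalH-mono-≤ (dictator k) = x⪯y k
  evalH-mono-≤ const0       = b≤b

module _ {l m : ℕ} where

  outcome : (Fin l → Fin m → Bool) → MuxOut l m → Bool
  outcome g zero*     = false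
  outcome g one*      = true
  outcome g (idx i j) = g i j

  selectClause : Fin l → List (Fin m) → MuxOut l m
  selectClause i []          = one*
  selectClause i (j ∷ [])    = idx i j
  selectClause i (_ ∷ _ ∷ _) = zero*

  select : List (Fin l) → (Fin l → List (Fin m)) → MuxOut l m
  select []          falsified = zero*
  select (i ∷ [])    falsified = selectClause i (falsified i)
  select (_ ∷ _ ∷ _) falsified = one*

  module _ {g g′ : Fin l → Fin m → Bool} (g≤g′ : ∀ i j → g i j ≤ g′ i j) where

    selectClause-antimono : ∀ i {js js′} → js′ ⊆ js →
                            outcome g (selectClause i js) ≤ outcome g′ (selectClause i js′)
    selectClause-antimono i []            = b≤b
    selectClause-antimono i (_ ∷ʳ [])     = ≤-maximum _
    selectClause-antimono i (refl ∷ [])   = g≤g′ i _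
    selectClause-antimono i {_ ∷ _ ∷ _} _ = ≤-minimum _

    select-mono : ∀ {is is′} {js js′ : Fin l → List (Fin m)} → is ⊆ is′ → (∀ i → js′ i ⊆ js i) →
                  outcome g (select is js) ≤ outcome g′ (select is′ js′)
    select-mono {[]}                    _           _      = ≤-minimum _
    select-mono {_ ∷ []}    {_ ∷ _ ∷ _} _           _      = ≤-maximum _
    select-mono {i ∷ []}    {_ ∷ []}    (_ ∷ʳ ())   _
    select-mono {i ∷ []}    {_ ∷ []}    (refl ∷ []) js′⊆js = selectClause-antimono i (js′⊆js i)
    select-mono {_ ∷ _ ∷ _} {_ ∷ _ ∷ _} _           _      = b≤b
    select-mono {_ ∷ _ ∷ _} {_ ∷ []}    (_ ∷ʳ ())   _
    select-mono {_ ∷ _ ∷ _} {_ ∷ []}    (refl ∷ ()) _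

module _ {n : ℕ} (T′ : Terms n) (C : Clauses n) where

  satisfiedTerms : Cube n → List (Fin (Lsize n))
  satisfiedTerms x = filterᵇ (λ i → evalTerm (T′ i) x) (allFin (Lsize n))

  falsifiedClauses : Cube n → Fin (Lsize n) → List (Fin (Msize n))
  falsifiedClauses x i = filterᵇ (λ j → not (evalClause (C i j) x)) (allFin (Msize n))

  Γ≡select : ∀ x → Γ T′ C x ≡ select (satisfiedTerms x) (falsifiedClauses x)
  Γ≡select x with satisfiedTerms x
  ... | []        = refl
  ... | _ ∷ _ ∷ _ = refl
  ... | i ∷ [] with falsifiedClauses x i
  ...   | []        = refl
  ...   | _ ∷ []    = refl
  ...   | _ ∷ _ ∷ _ = refl

  Γ-mono : ∀ {x y} {g g′ : Fin (Lsize n) → Fin (Msize n) → Bool} → x ⪯ y → (∀ i j → g i j ≤ g′ i j) →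
           outcome g (Γ T′ C x) ≤ outcome g′ (Γ T′ C y)
  Γ-mono {x} {y} x⪯y g≤g′ rewrite Γ≡select x | Γ≡select y =
    select-mono g≤g′ (filterᵇ-mono-⊆ (λ i → evalTerm-mono-≤ x⪯y (T′ i)) (allFin (Lsize n)))
                     (λ i → filterᵇ-mono-⊆ (λ j → not-antimono-≤ (evalClause-mono-≤ x⪯y (C i j))) (allFin (Msize n)))

  fYes≡threshold : ∀ h x → fYes T′ C h x ≡
                   threshold (3 * n / 4 + 1) (3 * n / 4) (weight x) (outcome (λ i j → evalH (h i j) x) (Γ T′ C x))
  fYes≡threshold h x with Γ T′ C x
  ... | zero*   = refl
  ... | one*    = refl
  ... | idx _ _ = refl

-- The hypothesis 4 ∣ n only makes 3n/4 exact; monotonicity holds for every n.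
lemma6p2 : (n : ℕ) → 4 ∣ n → (T : Terms n) (C : Clauses n) (h : Hs n) → Monotone (fYes T C h)
lemma6p2 n _ T′ C h x y x⪯y =
  subst₂ _≤_ (sym (fYes≡threshold T′ C h x)) (sym (fYes≡threshold T′ C h y))
    (threshold-mono (3 * n / 4 + 1) (3 * n / 4) (weight-mono-≤ x⪯y)
      (Γ-mono T′ C x⪯y (λ i j → evalH-mono-≤ x⪯y (h i j))))
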